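{- Let $n\ge1$ and $0\le k\le n-1$ be integers. Then $|PF_{n,k}|\le(k+1)(k+n+1)^{n-1}$, with equality only if $k=0$.
   Context: $PF_{n,k}$ is the set of $k$-Naples parking functions with $n$ cars and $n$ spots: tuples $(a_1,\dots,a_n)\in[n]^n$ of preferences of cars $c_1,\dots,c_n$ arriving in order on the directed path $1,\dots,n$, such that all cars park under the rule: car $c_j$ parks at $a_j$ if free; otherwise, if some vertex of $\{a_j-1,\dots,a_j-k\}\cap[n]$ is free it parks at the free one closest to $a_j$; otherwise it parks at the first free vertex after $a_j$ (failing if none exists). -}

module Defs where

open import Data.Nat using (ℕ; zero; suc; _+_; _∸_; _<ᵇ_; _≡ᵇ_)
open import Data.Bool using (Bool; true; false; if_then_else_; not)
open import Data.List using (List; []; _∷_; map; upTo; concatMap; filterᵇ; length)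
open import Data.Bool.ListAction using (any)
open import Data.Maybe using (Maybe; just; nothing; is-just)

-- Vertices of the directed path are 1,…,n; preferences are in [n] = {1,…,n}.
-- The parking state is the list of occupied vertices.

isFree : List ℕ → ℕ → Bool
isFree occ v = not (any (λ w → w ≡ᵇ v) occ)

firstFree : List ℕ → List ℕ → Maybe ℕ
firstFree occ [] = nothing
firstFree occ (v ∷ vs) = if isFree occ v then just v else firstFree occ vs

oneTo : ℕ → List ℕ
oneTo m = map suc (upTo m)

-- candidate backward spots a-1, a-2, …, a-k (closest first), restricted to [n],
-- i.e. only those a-d with d < a (so that a-d ≥ 1)
backward : ℕ → ℕ → List ℕ
backward k a = map (λ d → a ∸ d) (filterᵇ (λ d → d <ᵇ a) (oneTo k))

forward : ℕ → ℕ → List ℕ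
forward n a = map (λ i → a + suc i) (upTo (n ∸ a))

-- k-Naples rule: where a car with preference a parks (nothing = fails)
parkSpot : ℕ → ℕ → List ℕ → ℕ → Maybe ℕ
parkSpot n k occ a with isFree occ a
... | true = just a
... | false with firstFree occ (backward k a)
...   | just v = just v
...   | nothing = firstFree occ (forward n a)

runCars : ℕ → ℕ → List ℕ → List ℕ → Maybe (List ℕ)
runCars n k occ [] = just occ
runCars n k occ (a ∷ as) with parkSpot n k occ a
... | nothing = nothing
... | just v = runCars n k (v ∷ occ) as

isNaplesPF : ℕ → ℕ → List ℕ → Bool
isNaplesPF n k prefs = is-just (runCars n k [] prefs)

tuples : ℕ → ℕ → List (List ℕ)
tuples n zero = [] ∷ []
tuples n (suc m) = concatMap (λ a → map (a ∷_) (tuples n m)) (oneTo n)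

numPF : ℕ → ℕ → ℕ
numPF n k = length (filterᵇ (isNaplesPF n k) (tuples n n))

-- A k-Naples parking function (a₁, …, aₙ) satisfies #{i | aᵢ ≤ p} ≥ p ∸ k for every p:
-- a car preferring a spot beyond p parks beyond p ∸ k, and there are only n ∸ (p ∸ k)
-- such spots. Call the tuples in [N]ⁿ, N = n + k + 1, with this property slack parking
-- functions and count them by Pollak's circular argument: among the N cyclic shifts
-- (mod N) of any tuple at most k + 1 are slack, so there are at most (k + 1) Nⁿ⁻¹ of
-- them. For k ≥ 1 the bound is strict because the slack tuple (n + 1, 1, …, 1) lies
-- outside [n]ⁿ.
module Submission where

open import Defs
open import Data.Nat using (ℕ; zero; suc; _+_; _*_; _∸_; _^_; _≤_; _<_; z≤n; s≤s; z<s; s<s; _≤ᵇ_; _<ᵇ_; _≡ᵇ_)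
open import Data.Nat.Properties
open import Data.Nat.Tactic.RingSolver using (solve-∀)
open import Data.Bool using (Bool; true; false; if_then_else_; _∧_; T)
open import Data.List using (List; []; _∷_; map; filterᵇ; length; _++_; concat; applyUpTo; replicate)
open import Data.List.Properties using (length-replicate)
open import Data.List.Relation.Unary.All using (All; []; _∷_) renaming (map to All-map)
open import Data.List.Relation.Unary.Any using (here; there)
open import Data.List.Membership.Propositional using (_∈_)
open import Data.List.Membership.Propositional.Properties using (∈-map⁻; ∈-filter⁻; ∈-upTo⁻)
open import Data.Maybe using (just; nothing)
open import Data.Product using (_×_; _,_; proj₁; proj₂)
open import Data.Empty using (⊥-elim)
open import Data.Sum using (inj₁; inj₂)
open import Data.Unit using (tt)
open import Relation.Nullary using (yes; no; ¬_)
open import Relation.Nullary.Decidable using (T?)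
open import Relation.Binary.PropositionalEquality
open import Function using (_∘_; id)

⟦_⟧ : Bool → ℕ
⟦ true ⟧ = 1
⟦ false ⟧ = 0

⟦⟧≤1 : ∀ b → ⟦ b ⟧ ≤ 1
⟦⟧≤1 true = ≤-refl
⟦⟧≤1 false = z≤n

T⇒≡true : ∀ {b} → T b → b ≡ true
T⇒≡true {true} _ = refl

¬T⇒≡false : ∀ {b} → ¬ T b → b ≡ false
¬T⇒≡false {false} _ = refl
¬T⇒≡false {true} ¬t = ⊥-elim (¬t tt)

≡true⇒T : ∀ {b} → b ≡ true → T b
≡true⇒T refl = tt

≤ᵇ-true : ∀ {m n} → m ≤ n → (m ≤ᵇ n) ≡ true
≤ᵇ-true m≤n = T⇒≡true (≤⇒≤ᵇ m≤n)

≤ᵇ-false : ∀ {m n} → n < m → (m ≤ᵇ n) ≡ false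
≤ᵇ-false {m} {n} n<m = ¬T⇒≡false (<⇒≱ n<m ∘ ≤ᵇ⇒≤ m n)

<ᵇ-true : ∀ {m n} → m < n → (m <ᵇ n) ≡ true
<ᵇ-true m<n = T⇒≡true (<⇒<ᵇ m<n)

<ᵇ-false : ∀ {m n} → n ≤ m → (m <ᵇ n) ≡ false
<ᵇ-false {m} {n} n≤m = ¬T⇒≡false (≤⇒≯ n≤m ∘ <ᵇ⇒< m n)

<ᵇ-sound : ∀ {m n} → (m <ᵇ n) ≡ true → m < n
<ᵇ-sound {m} {n} eq = <ᵇ⇒< m n (≡true⇒T eq)

≡ᵇ-sound : ∀ {m n} → (m ≡ᵇ n) ≡ true → m ≡ n
≡ᵇ-sound {m} {n} eq = ≡ᵇ⇒≡ m n (≡true⇒T eq)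

≡ᵇ-refl : ∀ n → (n ≡ᵇ n) ≡ true
≡ᵇ-refl n = T⇒≡true (≡⇒≡ᵇ n n refl)

⟦≤ᵇ⟧-yes : ∀ {m n} → m ≤ n → ⟦ m ≤ᵇ n ⟧ ≡ 1
⟦≤ᵇ⟧-yes m≤n rewrite ≤ᵇ-true m≤n = refl

⟦≤ᵇ⟧-no : ∀ {m n} → n < m → ⟦ m ≤ᵇ n ⟧ ≡ 0
⟦≤ᵇ⟧-no n<m rewrite ≤ᵇ-false n<m = refl

⟦<ᵇ⟧-yes : ∀ {m n} → m < n → ⟦ m <ᵇ n ⟧ ≡ 1
⟦<ᵇ⟧-yes m<n rewrite <ᵇ-true m<n = refl

⟦<ᵇ⟧-no : ∀ {m n} → n ≤ m → ⟦ m <ᵇ n ⟧ ≡ 0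
⟦<ᵇ⟧-no n≤m rewrite <ᵇ-false n≤m = refl

⟦≤ᵇ⟧-cong : ∀ {a b c d} → (a ≤ b → c ≤ d) → (c ≤ d → a ≤ b) → ⟦ a ≤ᵇ b ⟧ ≡ ⟦ c ≤ᵇ d ⟧
⟦≤ᵇ⟧-cong {a} {b} to from with a ≤? b
... | yes a≤b rewrite ⟦≤ᵇ⟧-yes a≤b | ⟦≤ᵇ⟧-yes (to a≤b) = refl
... | no a≰b rewrite ⟦≤ᵇ⟧-no (≰⇒> a≰b) | ⟦≤ᵇ⟧-no (≰⇒> (a≰b ∘ from)) = refl

∀<ᵇ : ℕ → (ℕ → Bool) → Bool
∀<ᵇ zero f = true
∀<ᵇ (suc n) f = ∀<ᵇ n f ∧ f n

∀<ᵇ-elim : ∀ n f → ∀<ᵇ n f ≡ true → ∀ p → p < n → f p ≡ true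
∀<ᵇ-elim (suc n) f all p p<1+n with ∀<ᵇ n f in below | f n in at-n
∀<ᵇ-elim (suc n) f refl p p<1+n | true | true with m<1+n⇒m<n∨m≡n p<1+n
... | inj₁ p<n = ∀<ᵇ-elim n f below p p<n
... | inj₂ refl = at-n

∀<ᵇ-intro : ∀ n f → (∀ p → p < n → f p ≡ true) → ∀<ᵇ n f ≡ true
∀<ᵇ-intro zero f all = refl
∀<ᵇ-intro (suc n) f all
  rewrite ∀<ᵇ-intro n f (λ p p<n → all p (m<n⇒m<1+n p<n)) | all n ≤-refl = refl

-- Sums over tuples

+-interchange : ∀ a b c d → a + b + (c + d) ≡ a + c + (b + d)
+-interchange = solve-∀

+-left-comm : ∀ a b c → a + (b + c) ≡ b + (a + c)
+-left-comm = solve-∀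

Σ< : ℕ → (ℕ → ℕ) → ℕ
Σ< zero h = 0
Σ< (suc n) h = h 0 + Σ< n (h ∘ suc)

Σ<-cong : ∀ n {g h} → (∀ i → i < n → g i ≡ h i) → Σ< n g ≡ Σ< n h
Σ<-cong zero eq = refl
Σ<-cong (suc n) eq = cong₂ _+_ (eq 0 z<s) (Σ<-cong n (λ i i<n → eq (suc i) (s<s i<n)))

Σ<-mono : ∀ n {g h} → (∀ i → i < n → g i ≤ h i) → Σ< n g ≤ Σ< n h
Σ<-mono zero le = z≤n
Σ<-mono (suc n) le = +-mono-≤ (le 0 z<s) (Σ<-mono n (λ i i<n → le (suc i) (s<s i<n)))

Σ<-mono-length : ∀ {m n} h → m ≤ n → Σ< m h ≤ Σ< n h
Σ<-mono-length {zero} h _ = z≤n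
Σ<-mono-length {suc m} {suc n} h (s≤s m≤n) = +-monoʳ-≤ (h 0) (Σ<-mono-length (h ∘ suc) m≤n)

Σ<-<-length : ∀ {m n} h → m < n → 0 < h m → Σ< m h < Σ< n h
Σ<-<-length {zero} {suc n} h _ pos = <-≤-trans pos (m≤m+n _ _)
Σ<-<-length {suc m} {suc n} h (s≤s m<n) pos = +-monoʳ-< (h 0) (Σ<-<-length (h ∘ suc) m<n pos)

Σ<-term : ∀ n h i → i < n → h i ≤ Σ< n h
Σ<-term (suc n) h zero _ = m≤m+n (h 0) _
Σ<-term (suc n) h (suc i) (s≤s i<n) = ≤-trans (Σ<-term n (h ∘ suc) i i<n) (m≤n+m _ (h 0))

Σ<-+ : ∀ m n h → Σ< (m + n) h ≡ Σ< m h + Σ< n (λ j → h (m + j))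
Σ<-+ zero n h = refl
Σ<-+ (suc m) n h = trans (cong (h 0 +_) (Σ<-+ m n (h ∘ suc))) (sym (+-assoc (h 0) _ _))

Σ<-const : ∀ n c → Σ< n (λ _ → c) ≡ n * c
Σ<-const zero c = refl
Σ<-const (suc n) c = cong (c +_) (Σ<-const n c)

Σ<-distrib-+ : ∀ n (g h : ℕ → ℕ) → Σ< n (λ i → g i + h i) ≡ Σ< n g + Σ< n h
Σ<-distrib-+ zero g h = refl
Σ<-distrib-+ (suc n) g h = trans (cong (g 0 + h 0 +_) (Σ<-distrib-+ n (g ∘ suc) (h ∘ suc)))
                                 (+-interchange (g 0) (h 0) _ _)

Σ<-comm : ∀ m n (f : ℕ → ℕ → ℕ) → Σ< m (λ i → Σ< n (f i)) ≡ Σ< n (λ j → Σ< m (λ i → f i j))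
Σ<-comm zero n f = sym (trans (Σ<-const n 0) (*-zeroʳ n))
Σ<-comm (suc m) n f = trans (cong (Σ< n (f 0) +_) (Σ<-comm m n (f ∘ suc)))
                            (sym (Σ<-distrib-+ n (f 0) _))

InRange : ℕ → ℕ → Set
InRange N v = 0 < v × v ≤ N

tupleSum : ℕ → ℕ → (List ℕ → ℕ) → ℕ
tupleSum N zero w = w []
tupleSum N (suc m) w = Σ< N (λ i → tupleSum N m (λ t → w (suc i ∷ t)))

length-filterᵇ-++ : ∀ (P : List ℕ → Bool) xs ys →
  length (filterᵇ P (xs ++ ys)) ≡ length (filterᵇ P xs) + length (filterᵇ P ys)
length-filterᵇ-++ P [] ys = refl
length-filterᵇ-++ P (x ∷ xs) ys with P x
... | true = cong suc (length-filterᵇ-++ P xs ys)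
... | false = length-filterᵇ-++ P xs ys

length-filterᵇ-cons : ∀ (P : List ℕ → Bool) a ts →
  length (filterᵇ P (map (a ∷_) ts)) ≡ length (filterᵇ (λ t → P (a ∷ t)) ts)
length-filterᵇ-cons P a [] = refl
length-filterᵇ-cons P a (t ∷ ts) with P (a ∷ t)
... | true = cong suc (length-filterᵇ-cons P a ts)
... | false = length-filterᵇ-cons P a ts

length-filterᵇ-concat : ∀ (P : List ℕ → Bool) (F : ℕ → List (List ℕ)) N g →
  length (filterᵇ P (concat (map F (map suc (applyUpTo g N)))))
    ≡ Σ< N (λ i → length (filterᵇ P (F (suc (g i)))))
length-filterᵇ-concat P F zero g = refl
length-filterᵇ-concat P F (suc N) g =
  trans (length-filterᵇ-++ P (F (suc (g 0))) _)
        (cong (length (filterᵇ P (F (suc (g 0)))) +_) (length-filterᵇ-concat P F N (g ∘ suc)))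

length-filterᵇ-tuples : ∀ N m P → length (filterᵇ P (tuples N m)) ≡ tupleSum N m (⟦_⟧ ∘ P)
length-filterᵇ-tuples N zero P with P []
... | true = refl
... | false = refl
length-filterᵇ-tuples N (suc m) P =
  trans (length-filterᵇ-concat P (λ a → map (a ∷_) (tuples N m)) N id)
        (Σ<-cong N (λ i _ → trans (length-filterᵇ-cons P (suc i) (tuples N m))
                                  (length-filterᵇ-tuples N m (λ t → P (suc i ∷ t)))))

tupleSum-mono : ∀ N m {v w} → (∀ t → All (InRange N) t → length t ≡ m → v t ≤ w t) →
  tupleSum N m v ≤ tupleSum N m w
tupleSum-mono N zero le = le [] [] refl
tupleSum-mono N (suc m) le =
  Σ<-mono N (λ i i<N →
    tupleSum-mono N m (λ t t∈ |t| → le (suc i ∷ t) ((z<s , i<N) ∷ t∈) (cong suc |t|)))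

tupleSum-cong : ∀ N m {v w} → (∀ t → All (InRange N) t → length t ≡ m → v t ≡ w t) →
  tupleSum N m v ≡ tupleSum N m w
tupleSum-cong N m eq = ≤-antisym (tupleSum-mono N m (λ t t∈ |t| → ≤-reflexive (eq t t∈ |t|)))
                                 (tupleSum-mono N m (λ t t∈ |t| → ≤-reflexive (sym (eq t t∈ |t|))))

tupleSum-const : ∀ N m c → tupleSum N m (λ _ → c) ≡ c * N ^ m
tupleSum-const N zero c = sym (*-identityʳ c)
tupleSum-const N (suc m) c = begin
  Σ< N (λ _ → tupleSum N m (λ _ → c)) ≡⟨ Σ<-cong N (λ i _ → tupleSum-const N m c) ⟩
  Σ< N (λ _ → c * N ^ m)              ≡⟨ Σ<-const N (c * N ^ m) ⟩
  N * (c * N ^ m)                     ≡⟨ rearrange N c (N ^ m) ⟩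
  c * (N * N ^ m)                     ∎
  where
    open ≡-Reasoning
    rearrange : ∀ a b c → a * (b * c) ≡ b * (a * c)
    rearrange = solve-∀

tupleSum-Σ< : ∀ N m n (f : ℕ → List ℕ → ℕ) →
  tupleSum N m (λ t → Σ< n (λ i → f i t)) ≡ Σ< n (λ i → tupleSum N m (f i))
tupleSum-Σ< N zero n f = refl
tupleSum-Σ< N (suc m) n f =
  trans (Σ<-cong N (λ j _ → tupleSum-Σ< N m n (λ i t → f i (suc j ∷ t))))
        (Σ<-comm N n (λ j i → tupleSum N m (λ t → f i (suc j ∷ t))))

tupleSum-mono-range : ∀ {M N} m w → M ≤ N → tupleSum M m w ≤ tupleSum N m w
tupleSum-mono-range zero w M≤N = ≤-refl
tupleSum-mono-range {M} {N} (suc m) w M≤N =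
  ≤-trans (Σ<-mono M (λ i _ → tupleSum-mono-range m _ M≤N)) (Σ<-mono-length _ M≤N)

tupleSum-term : ∀ N m w t → All (InRange N) t → length t ≡ m → w t ≤ tupleSum N m w
tupleSum-term N zero w [] [] refl = ≤-refl
tupleSum-term N (suc m) w (suc i ∷ t) ((_ , i<N) ∷ t∈) |t| =
  ≤-trans (tupleSum-term N m (λ t' → w (suc i ∷ t')) t t∈ (suc-injective |t|)) (Σ<-term N _ i i<N)

tupleSum-<-range : ∀ {M N} m w → M < N → 0 < tupleSum N m (λ t → w (suc M ∷ t)) →
  tupleSum M (suc m) w < tupleSum N (suc m) w
tupleSum-<-range {M} {N} m w M<N pos =
  ≤-<-trans (Σ<-mono M (λ i _ → tupleSum-mono-range m _ (<⇒≤ M<N)))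
            (Σ<-<-length (λ i → tupleSum N m (λ t → w (suc i ∷ t))) M<N pos)

rotate : ℕ → ℕ → ℕ → ℕ
rotate N r v = if v + r ≤ᵇ N then v + r else v + r ∸ N

rotate-1 : ∀ N i → i < N → rotate N i 1 ≡ suc i
rotate-1 N i i<N rewrite ≤ᵇ-true i<N = refl

Σ<-rotate : ∀ N r (g : ℕ → ℕ) → r ≤ N → Σ< N (λ i → g (rotate N r (suc i))) ≡ Σ< N (g ∘ suc)
Σ<-rotate N r g r≤N rewrite sym (m∸n+n≡m r≤N) = split (N ∸ r)
  where
    open ≡-Reasoning
    split : ∀ s → Σ< (s + r) (λ i → g (rotate (s + r) r (suc i))) ≡ Σ< (s + r) (g ∘ suc)
    split s = begin
      Σ< (s + r) (λ i → g (rotate (s + r) r (suc i)))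
        ≡⟨ Σ<-+ s r _ ⟩
      Σ< s (λ i → g (rotate (s + r) r (suc i))) + Σ< r (λ j → g (rotate (s + r) r (suc (s + j))))
        ≡⟨ cong₂ _+_ (Σ<-cong s unwrapped) (Σ<-cong r wrapped) ⟩
      Σ< s (λ i → g (suc (r + i))) + Σ< r (g ∘ suc)
        ≡⟨ +-comm (Σ< s (λ i → g (suc (r + i)))) _ ⟩
      Σ< r (g ∘ suc) + Σ< s (λ i → g (suc (r + i)))
        ≡⟨ sym (Σ<-+ r s (g ∘ suc)) ⟩
      Σ< (r + s) (g ∘ suc)
        ≡⟨ cong (λ n → Σ< n (g ∘ suc)) (+-comm r s) ⟩
      Σ< (s + r) (g ∘ suc) ∎
      where
        shift : ∀ i r → suc i + r ≡ suc (r + i)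
        shift = solve-∀
        wrap : ∀ s j r → suc (s + j) + r ≡ suc j + (s + r)
        wrap = solve-∀
        unwrapped : ∀ i → i < s → g (rotate (s + r) r (suc i)) ≡ g (suc (r + i))
        unwrapped i i<s rewrite ≤ᵇ-true (+-monoˡ-≤ r i<s) = cong g (shift i r)
        wrapped : ∀ j → j < r → g (rotate (s + r) r (suc (s + j))) ≡ g (suc j)
        wrapped j j<r rewrite ≤ᵇ-false {suc (s + j) + r} {s + r} (s≤s (+-monoˡ-≤ r (m≤m+n s j)))
          = cong g (trans (cong (_∸ (s + r)) (wrap s j r)) (m+n∸n≡m (suc j) (s + r)))

tupleSum-rotate : ∀ N m r w → r ≤ N → tupleSum N m (λ t → w (map (rotate N r) t)) ≡ tupleSum N m w
tupleSum-rotate N zero r w r≤N = refl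
tupleSum-rotate N (suc m) r w r≤N =
  trans (Σ<-cong N (λ i _ → tupleSum-rotate N m r (λ t → w (rotate N r (suc i) ∷ t)) r≤N))
        (Σ<-rotate N r (λ a → tupleSum N m (λ t → w (a ∷ t))) r≤N)

-- Slack parking functions and Pollak's argument

#≤ : ℕ → List ℕ → ℕ
#≤ p [] = 0
#≤ p (v ∷ t) = ⟦ v ≤ᵇ p ⟧ + #≤ p t

#≤-0 : ∀ N t → All (InRange N) t → #≤ 0 t ≡ 0
#≤-0 N [] [] = refl
#≤-0 N (suc v ∷ t) (_ ∷ t∈) = #≤-0 N t t∈

#≤-max : ∀ N t → All (InRange N) t → #≤ N t ≡ length t
#≤-max N [] [] = refl
#≤-max N (v ∷ t) ((_ , v≤N) ∷ t∈) rewrite ⟦≤ᵇ⟧-yes v≤N = cong suc (#≤-max N t t∈)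

-- Shifting by r moves the entries ≤ N ∸ r up by r and wraps the others around to [1, r].

#≤-rotate-≥ : ∀ N r q b → r ≤ N → q + r < N → All (InRange N) b →
  #≤ (q + r) (map (rotate N r) b) + #≤ (N ∸ r) b ≡ #≤ q b + length b
#≤-rotate-≥ N r q [] _ _ [] = refl
#≤-rotate-≥ N r q (v ∷ b) r≤N q+r<N ((_ , v≤N) ∷ b∈) =
  trans (+-interchange ⟦ rotate N r v ≤ᵇ q + r ⟧ _ ⟦ v ≤ᵇ N ∸ r ⟧ _)
        (trans (cong₂ _+_ entry (#≤-rotate-≥ N r q b r≤N q+r<N b∈))
               (regroup ⟦ v ≤ᵇ q ⟧ _ _))
  where
    regroup : ∀ a c l → a + 1 + (c + l) ≡ a + c + suc l
    regroup = solve-∀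
    entry : ⟦ rotate N r v ≤ᵇ q + r ⟧ + ⟦ v ≤ᵇ N ∸ r ⟧ ≡ ⟦ v ≤ᵇ q ⟧ + 1
    entry with v + r ≤? N
    ... | yes v+r≤N rewrite ≤ᵇ-true v+r≤N | ⟦≤ᵇ⟧-yes (m+n≤o⇒m≤o∸n v v+r≤N) =
      cong (_+ 1) (⟦≤ᵇ⟧-cong (+-cancelʳ-≤ r v q) (+-monoˡ-≤ r))
    ... | no v+r≰N rewrite ≤ᵇ-false (≰⇒> v+r≰N)
          | ⟦≤ᵇ⟧-yes {v + r ∸ N} {q + r} (≤-trans (m≤n+o⇒m∸n≤o (v + r) N (+-monoˡ-≤ r v≤N)) (m≤n+m r q))
          | ⟦≤ᵇ⟧-no {v} {N ∸ r} (≰⇒> (v+r≰N ∘ m≤o∸n⇒m+n≤o v r≤N))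
          | ⟦≤ᵇ⟧-no {v} {q} (+-cancelʳ-< r q v (<-trans q+r<N (≰⇒> v+r≰N))) = refl

#≤-rotate-< : ∀ N r p b → r ≤ N → p < r → All (InRange N) b →
  #≤ p (map (rotate N r) b) + #≤ (N ∸ r) b ≡ #≤ (N ∸ r + p) b
#≤-rotate-< N r p [] _ _ [] = refl
#≤-rotate-< N r p (v ∷ b) r≤N p<r ((_ , v≤N) ∷ b∈) =
  trans (+-interchange ⟦ rotate N r v ≤ᵇ p ⟧ _ ⟦ v ≤ᵇ N ∸ r ⟧ _)
        (cong₂ _+_ entry (#≤-rotate-< N r p b r≤N p<r b∈))
  where
    unwrap : N < v + r → v ≡ N ∸ r + (v + r ∸ N)
    unwrap N<v+r = +-cancelʳ-≡ r v _ (begin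
      v + r                           ≡⟨ sym (m+[n∸m]≡n (<⇒≤ N<v+r)) ⟩
      N + (v + r ∸ N)                 ≡⟨ cong (_+ (v + r ∸ N)) (sym (m∸n+n≡m r≤N)) ⟩
      N ∸ r + r + (v + r ∸ N)         ≡⟨ swap (N ∸ r) r _ ⟩
      N ∸ r + (v + r ∸ N) + r         ∎)
      where
        open ≡-Reasoning
        swap : ∀ a r e → a + r + e ≡ a + e + r
        swap = solve-∀
    entry : ⟦ rotate N r v ≤ᵇ p ⟧ + ⟦ v ≤ᵇ N ∸ r ⟧ ≡ ⟦ v ≤ᵇ N ∸ r + p ⟧
    entry with v + r ≤? N
    ... | yes v+r≤N rewrite ≤ᵇ-true v+r≤N | ⟦≤ᵇ⟧-no {v + r} {p} (≤-trans p<r (m≤n+m r v))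
          | ⟦≤ᵇ⟧-yes (m+n≤o⇒m≤o∸n v v+r≤N)
          | ⟦≤ᵇ⟧-yes (≤-trans (m+n≤o⇒m≤o∸n v v+r≤N) (m≤m+n (N ∸ r) p)) = refl
    ... | no v+r≰N rewrite ≤ᵇ-false (≰⇒> v+r≰N)
          | ⟦≤ᵇ⟧-no {v} {N ∸ r} (≰⇒> (v+r≰N ∘ m≤o∸n⇒m+n≤o v r≤N))
          | +-identityʳ ⟦ v + r ∸ N ≤ᵇ p ⟧ =
      ⟦≤ᵇ⟧-cong (λ le → subst (_≤ N ∸ r + p) (sym (unwrap (≰⇒> v+r≰N))) (+-monoʳ-≤ (N ∸ r) le))
                (λ le → +-cancelˡ-≤ (N ∸ r) _ _ (subst (_≤ N ∸ r + p) (unwrap (≰⇒> v+r≰N)) le))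

Σ<-⟦⟧-≤-range : ∀ n (f : ℕ → Bool) (F : ℕ → ℕ) L H →
  (∀ i → i < n → f i ≡ true → L ≤ F i × F i < H) →
  (∀ i j → i < j → j < n → f i ≡ true → f j ≡ true → F i < F j) →
  Σ< n (⟦_⟧ ∘ f) ≤ H ∸ L
Σ<-⟦⟧-≤-range zero _ _ _ _ _ _ = z≤n
Σ<-⟦⟧-≤-range (suc n) f F L H inside increasing with f 0 in f0
... | false = Σ<-⟦⟧-≤-range n (f ∘ suc) (F ∘ suc) L H
                (λ i i<n → inside (suc i) (s<s i<n))
                (λ i j i<j j<n → increasing (suc i) (suc j) (s<s i<j) (s<s j<n))
... | true with inside 0 z<s f0
... | L≤F0 , F0<H = ≤-trans (s≤s rest) (≤-trans (≤-reflexive (sym (+-∸-assoc 1 F0<H))) (∸-monoʳ-≤ H L≤F0))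
  where
    rest : Σ< n (⟦_⟧ ∘ f ∘ suc) ≤ H ∸ suc (F 0)
    rest = Σ<-⟦⟧-≤-range n (f ∘ suc) (F ∘ suc) (suc (F 0)) H
             (λ i i<n fi → increasing 0 (suc i) z<s (s<s i<n) f0 fi , proj₂ (inside (suc i) (s<s i<n) fi))
             (λ i j i<j j<n → increasing (suc i) (suc j) (s<s i<j) (s<s j<n))

Σ<-⟦⟧-≤-spread : ∀ n (f : ℕ → Bool) (F : ℕ → ℕ) x → 0 < x →
  (∀ i j → i < j → j < n → f i ≡ true → f j ≡ true → F i < F j × F j < F i + x) →
  Σ< n (⟦_⟧ ∘ f) ≤ x
Σ<-⟦⟧-≤-spread zero _ _ _ _ _ = z≤n
Σ<-⟦⟧-≤-spread (suc n) f F x x>0 spread with f 0 in f0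
... | false = Σ<-⟦⟧-≤-spread n (f ∘ suc) (F ∘ suc) x x>0
                (λ i j i<j j<n → spread (suc i) (suc j) (s<s i<j) (s<s j<n))
... | true = subst (_≤ x) (cong (λ b → ⟦ b ⟧ + Σ< n (⟦_⟧ ∘ f ∘ suc)) f0)
               (subst (Σ< (suc n) (⟦_⟧ ∘ f) ≤_) (m+n∸m≡n (F 0) x)
                  (Σ<-⟦⟧-≤-range (suc n) f F (F 0) (F 0 + x) inside
                     (λ i j i<j j<n fi fj → proj₁ (spread i j i<j j<n fi fj))))
  where
    inside : ∀ i → i < suc n → f i ≡ true → F 0 ≤ F i × F i < F 0 + x
    inside zero _ _ = ≤-refl , m<m+n (F 0) x>0
    inside (suc i) i<n fi with spread 0 (suc i) z<s i<n f0 fi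
    ... | F0<Fi , Fi<F0+x = <⇒≤ F0<Fi , Fi<F0+x

-- For x = 1 this is the classical parking condition; with x = k + 1 it is the
-- condition #{i | tᵢ ≤ p} ≥ p ∸ k met by k-Naples parking functions.
isSlackPF : ℕ → ℕ → List ℕ → Bool
isSlackPF N x t = ∀<ᵇ N (λ p → p <ᵇ #≤ p t + x)

slack-at : ∀ N x t → isSlackPF N x t ≡ true → ∀ p → p < N → p < #≤ p t + x
slack-at N x t slack p p<N = <ᵇ-sound (∀<ᵇ-elim N (λ p → p <ᵇ #≤ p t + x) slack p p<N)

module Rotations (N x : ℕ) (b : List ℕ) (b∈ : All (InRange N) b) (|b|+x≡N : length b + x ≡ N) where

  isSlackShift : ℕ → Bool
  isSlackShift r = isSlackPF N x (map (rotate N r) b)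

  -- The potential of a shift increases strictly along the slack shifts, but by less
  -- than x in total; hence at most x shifts are slack.
  potential : ℕ → ℕ
  potential r = #≤ (N ∸ r) b + r

  -- The slack condition of shift r at level q + r, resp. q + r ∸ N, read off in b.
  potential-bound-≥ : ∀ r q → r ≤ N → isSlackShift r ≡ true → q + r < N →
    potential r + q < #≤ q b + N
  potential-bound-≥ r q r≤N slack q+r<N = begin-strict
    #≤ (N ∸ r) b + r + q            ≡⟨ rearrange (#≤ (N ∸ r) b) r q ⟩
    q + r + #≤ (N ∸ r) b            <⟨ +-monoˡ-< _ (slack-at N x b′ slack (q + r) q+r<N) ⟩
    #≤ (q + r) b′ + x + #≤ (N ∸ r) b ≡⟨ regroup (#≤ (q + r) b′) x _ ⟩
    #≤ (q + r) b′ + #≤ (N ∸ r) b + x ≡⟨ cong (_+ x) (#≤-rotate-≥ N r q b r≤N q+r<N b∈) ⟩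
    #≤ q b + length b + x           ≡⟨ +-assoc (#≤ q b) _ x ⟩
    #≤ q b + (length b + x)         ≡⟨ cong (#≤ q b +_) |b|+x≡N ⟩
    #≤ q b + N                      ∎
    where
      open ≤-Reasoning
      b′ : List ℕ
      b′ = map (rotate N r) b
      rearrange : ∀ s r q → s + r + q ≡ q + r + s
      rearrange = solve-∀
      regroup : ∀ t x s → t + x + s ≡ t + s + x
      regroup = solve-∀

  potential-bound-< : ∀ r q → r ≤ N → isSlackShift r ≡ true → q < N → N ≤ q + r →
    potential r + q < #≤ q b + N + x
  potential-bound-< r q r≤N slack q<N N≤q+r
    with m≤n⇒∃[o]m+o≡n (m≤n+o⇒m∸n≤o N r (subst (N ≤_) (+-comm q r) N≤q+r))
  ... | p , refl = begin-strict
    s + r + (N ∸ r + p)       ≡⟨ rearrange s r (N ∸ r) p ⟩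
    s + (N ∸ r + r) + p       ≡⟨ cong (λ n → s + n + p) (m∸n+n≡m r≤N) ⟩
    s + N + p                 <⟨ +-monoʳ-< (s + N) (slack-at N x b′ slack p (<-≤-trans p<r r≤N)) ⟩
    s + N + (#≤ p b′ + x)     ≡⟨ regroup s N (#≤ p b′) x ⟩
    #≤ p b′ + s + N + x       ≡⟨ cong (λ n → n + N + x) (#≤-rotate-< N r p b r≤N p<r b∈) ⟩
    #≤ (N ∸ r + p) b + N + x  ∎
    where
      open ≤-Reasoning
      s : ℕ
      s = #≤ (N ∸ r) b
      b′ : List ℕ
      b′ = map (rotate N r) b
      p<r : p < r
      p<r = +-cancelˡ-< (N ∸ r) p r (subst (N ∸ r + p <_) (sym (m∸n+n≡m r≤N)) q<N)
      rearrange : ∀ s r u p → s + r + (u + p) ≡ s + (u + r) + p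
      rearrange = solve-∀
      regroup : ∀ s N t x → s + N + (t + x) ≡ t + s + N + x
      regroup = solve-∀

  potential-increasing : ∀ i j → i < j → j ≤ N → isSlackShift i ≡ true → potential i < potential j
  potential-increasing i j i<j j≤N slack =
    +-cancelʳ-< (N ∸ j) (potential i) (potential j)
      (subst (potential i + (N ∸ j) <_) (sym around)
        (potential-bound-≥ i (N ∸ j) (<⇒≤ (<-≤-trans i<j j≤N)) slack below))
    where
      below : N ∸ j + i < N
      below = subst (N ∸ j + i <_) (m∸n+n≡m j≤N) (+-monoʳ-< (N ∸ j) i<j)
      around : potential j + (N ∸ j) ≡ #≤ (N ∸ j) b + N
      around = trans (+-assoc (#≤ (N ∸ j) b) j _) (cong (#≤ (N ∸ j) b +_) (m+[n∸m]≡n j≤N))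

  potential-spread : ∀ i j → i < j → j < N → isSlackShift j ≡ true → potential j < potential i + x
  potential-spread zero j _ j<N slack = begin-strict
    potential j         ≡⟨ sym (+-identityʳ _) ⟩
    potential j + 0     <⟨ potential-bound-≥ j 0 (<⇒≤ j<N) slack j<N ⟩
    #≤ 0 b + N          ≡⟨ cong (_+ N) (#≤-0 N b b∈) ⟩
    N                   ≡⟨ sym |b|+x≡N ⟩
    length b + x        ≡⟨ cong (_+ x) (sym (trans (+-identityʳ _) (#≤-max N b b∈))) ⟩
    potential 0 + x     ∎
    where open ≤-Reasoning
  potential-spread (suc i) j i<j j<N slack =
    +-cancelʳ-< (N ∸ suc i) (potential j) (potential (suc i) + x)
      (begin-strict
        potential j + (N ∸ suc i)         <⟨ potential-bound-< j (N ∸ suc i) (<⇒≤ j<N) slack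
                                               (∸-monoʳ-< z<s i≤N) wraps ⟩
        #≤ (N ∸ suc i) b + N + x          ≡⟨ cong (λ n → #≤ (N ∸ suc i) b + n + x) (sym (m+[n∸m]≡n i≤N)) ⟩
        #≤ (N ∸ suc i) b + (suc i + (N ∸ suc i)) + x ≡⟨ regroup (#≤ (N ∸ suc i) b) (suc i) _ x ⟩
        potential (suc i) + x + (N ∸ suc i) ∎)
    where
      open ≤-Reasoning
      i≤N : suc i ≤ N
      i≤N = <⇒≤ (<-trans i<j j<N)
      wraps : N ≤ N ∸ suc i + j
      wraps = ≤-trans (≤-reflexive (sym (m∸n+n≡m i≤N))) (+-monoʳ-≤ (N ∸ suc i) (<⇒≤ i<j))
      regroup : ∀ s i u x → s + (i + u) + x ≡ s + i + x + u
      regroup = solve-∀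

  slackShifts≤ : 0 < x → Σ< N (⟦_⟧ ∘ isSlackShift) ≤ x
  slackShifts≤ x>0 = Σ<-⟦⟧-≤-spread N isSlackShift potential x x>0
    (λ i j i<j j<N slack-i slack-j →
       potential-increasing i j i<j (<⇒≤ j<N) slack-i , potential-spread i j i<j j<N slack-j)

tupleSum-by-rotations : ∀ N m w →
  tupleSum N (suc m) w ≡ tupleSum N m (λ t → Σ< N (λ i → w (map (rotate N i) (1 ∷ t))))
tupleSum-by-rotations N m w = begin
  Σ< N (λ i → tupleSum N m (λ t → w (suc i ∷ t)))
    ≡⟨ Σ<-cong N (λ i i<N → sym (trans (tupleSum-cong N m (λ t _ _ → first-entry i i<N t))
                                       (tupleSum-rotate N m i (λ t → w (suc i ∷ t)) (<⇒≤ i<N)))) ⟩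
  Σ< N (λ i → tupleSum N m (λ t → w (map (rotate N i) (1 ∷ t))))
    ≡⟨ sym (tupleSum-Σ< N m N (λ i t → w (map (rotate N i) (1 ∷ t)))) ⟩
  tupleSum N m (λ t → Σ< N (λ i → w (map (rotate N i) (1 ∷ t)))) ∎
  where
    open ≡-Reasoning
    first-entry : ∀ i → i < N → ∀ t → w (map (rotate N i) (1 ∷ t)) ≡ w (suc i ∷ map (rotate N i) t)
    first-entry i i<N t = cong (λ v → w (v ∷ map (rotate N i) t)) (rotate-1 N i i<N)

tupleSum-slackPF≤ : ∀ N x m → suc m + x ≡ N → 0 < x →
  tupleSum N (suc m) (⟦_⟧ ∘ isSlackPF N x) ≤ x * N ^ m
tupleSum-slackPF≤ N x m 1+m+x≡N x>0 = begin
  tupleSum N (suc m) (⟦_⟧ ∘ isSlackPF N x)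
    ≡⟨ tupleSum-by-rotations N m (⟦_⟧ ∘ isSlackPF N x) ⟩
  tupleSum N m (λ t → Σ< N (λ i → ⟦ isSlackPF N x (map (rotate N i) (1 ∷ t)) ⟧))
    ≤⟨ tupleSum-mono N m (λ t t∈ |t| → Rotations.slackShifts≤ N x (1 ∷ t) ((z<s , 1≤N) ∷ t∈)
                                          (trans (cong (λ l → suc l + x) |t|) 1+m+x≡N) x>0) ⟩
  tupleSum N m (λ _ → x)
    ≡⟨ tupleSum-const N m x ⟩
  x * N ^ m ∎
  where
    open ≤-Reasoning
    1≤N : 1 ≤ N
    1≤N = subst (1 ≤_) 1+m+x≡N (s≤s z≤n)

-- Naples parking functions are slack

#> : ℕ → List ℕ → ℕ
#> p [] = 0
#> p (v ∷ t) = ⟦ p <ᵇ v ⟧ + #> p t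

#≤+#>≡length : ∀ p t → #≤ p t + #> p t ≡ length t
#≤+#>≡length p [] = refl
#≤+#>≡length p (v ∷ t) with v ≤? p
... | yes v≤p rewrite ⟦≤ᵇ⟧-yes v≤p | ⟦<ᵇ⟧-no v≤p = cong suc (#≤+#>≡length p t)
... | no v≰p rewrite ⟦≤ᵇ⟧-no (≰⇒> v≰p) | ⟦<ᵇ⟧-yes (≰⇒> v≰p) =
  trans (+-suc (#≤ p t) _) (cong suc (#≤+#>≡length p t))

data Distinct : List ℕ → Set where
  [] : Distinct []
  _∷_ : ∀ {v vs} → isFree vs v ≡ true → Distinct vs → Distinct (v ∷ vs)

remove : ℕ → List ℕ → List ℕ
remove c [] = []
remove c (v ∷ vs) = if v ≡ᵇ c then remove c vs else v ∷ remove c vs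

#≡ : ℕ → List ℕ → ℕ
#≡ c [] = 0
#≡ c (v ∷ vs) = ⟦ v ≡ᵇ c ⟧ + #≡ c vs

isFree-∷ : ∀ w ws v → isFree (w ∷ ws) v ≡ true → (w ≡ᵇ v) ≡ false × isFree ws v ≡ true
isFree-∷ w ws v free with w ≡ᵇ v
... | false = refl , free

#≡-free : ∀ c vs → isFree vs c ≡ true → #≡ c vs ≡ 0
#≡-free c [] free = refl
#≡-free c (w ∷ ws) free with isFree-∷ w ws c free
... | w≢c , free′ rewrite w≢c = #≡-free c ws free′

#≡-distinct≤1 : ∀ c vs → Distinct vs → #≡ c vs ≤ 1
#≡-distinct≤1 c [] [] = z≤n
#≡-distinct≤1 c (v ∷ vs) (free ∷ distinct) with v ≡ᵇ c in v≡c
... | true rewrite #≡-free c vs (subst (λ z → isFree vs z ≡ true) (≡ᵇ-sound v≡c) free) = ≤-refl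
... | false = #≡-distinct≤1 c vs distinct

remove-free : ∀ c v vs → isFree vs v ≡ true → isFree (remove c vs) v ≡ true
remove-free c v [] free = refl
remove-free c v (w ∷ ws) free with isFree-∷ w ws v free
... | w≢v , free′ with w ≡ᵇ c
... | true = remove-free c v ws free′
... | false rewrite w≢v = remove-free c v ws free′

remove-distinct : ∀ c vs → Distinct vs → Distinct (remove c vs)
remove-distinct c [] [] = []
remove-distinct c (v ∷ vs) (free ∷ distinct) with v ≡ᵇ c
... | true = remove-distinct c vs distinct
... | false = remove-free c v vs free ∷ remove-distinct c vs distinct

remove-max : ∀ h vs → All (_≤ suc h) vs → All (_≤ h) (remove (suc h) vs)
remove-max h [] [] = []
remove-max h (v ∷ vs) (v≤1+h ∷ vs≤) with v ≡ᵇ suc h in v≡?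
... | true = remove-max h vs vs≤
... | false = ≤-pred (≤∧≢⇒< v≤1+h v≢1+h) ∷ remove-max h vs vs≤
  where
    v≢1+h : v ≢ suc h
    v≢1+h refl with () ← trans (sym v≡?) (≡ᵇ-refl (suc h))

#>-remove : ∀ lo c vs → #> lo vs ≤ #≡ c vs + #> lo (remove c vs)
#>-remove lo c [] = z≤n
#>-remove lo c (v ∷ vs) with v ≡ᵇ c
... | true = +-mono-≤ (⟦⟧≤1 (lo <ᵇ v)) (#>-remove lo c vs)
... | false = ≤-trans (+-monoʳ-≤ ⟦ lo <ᵇ v ⟧ (#>-remove lo c vs))
                      (≤-reflexive (+-left-comm ⟦ lo <ᵇ v ⟧ (#≡ c vs) _))

#>-all≤ : ∀ lo vs → All (_≤ lo) vs → #> lo vs ≡ 0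
#>-all≤ lo [] [] = refl
#>-all≤ lo (v ∷ vs) (v≤lo ∷ vs≤) rewrite ⟦<ᵇ⟧-no v≤lo = #>-all≤ lo vs vs≤

#>-distinct≤ : ∀ hi lo vs → Distinct vs → All (_≤ hi) vs → #> lo vs ≤ hi ∸ lo
#>-distinct≤ hi lo vs distinct vs≤ with hi ≤? lo
... | yes hi≤lo = subst (_≤ hi ∸ lo) (sym (#>-all≤ lo vs (All-map (λ le → ≤-trans le hi≤lo) vs≤))) z≤n
#>-distinct≤ zero lo vs _ _ | no 0≰lo = ⊥-elim (0≰lo z≤n)
#>-distinct≤ (suc h) lo vs distinct vs≤ | no h≮lo =
  ≤-trans (#>-remove lo (suc h) vs)
    (≤-trans (+-mono-≤ (#≡-distinct≤1 (suc h) vs distinct)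
                       (#>-distinct≤ h lo (remove (suc h) vs) (remove-distinct (suc h) vs distinct)
                                     (remove-max h vs vs≤)))
             (≤-reflexive (sym (+-∸-assoc 1 (≤-pred (≰⇒> h≮lo))))))

firstFree-spec : ∀ occ vs w → firstFree occ vs ≡ just w → isFree occ w ≡ true × w ∈ vs
firstFree-spec occ (v ∷ vs) w found with isFree occ v in free
firstFree-spec occ (v ∷ vs) w refl | true = free , here refl
... | false with firstFree-spec occ vs w found
... | free′ , w∈vs = free′ , there w∈vs

backward-spec : ∀ k a w → w ∈ backward k a → 0 < w × w ≤ a × a ≤ w + k
backward-spec k a w w∈ with ∈-map⁻ (λ d → a ∸ d) w∈
... | d , d∈ , refl with ∈-filter⁻ (T? ∘ (λ d → d <ᵇ a)) {xs = oneTo k} d∈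
... | d∈′ , d<a with ∈-map⁻ suc d∈′
... | i , i∈ , refl =
  m<n⇒0<n∸m (<ᵇ⇒< (suc i) a d<a) ,
  m∸n≤m a (suc i) ,
  ≤-trans (≤-reflexive (sym (m∸n+n≡m (<⇒≤ (<ᵇ⇒< (suc i) a d<a)))))
          (+-monoʳ-≤ (a ∸ suc i) (∈-upTo⁻ i∈))

forward-spec : ∀ n a w → a ≤ n → w ∈ forward n a → 0 < w × w ≤ n × a ≤ w
forward-spec n a w a≤n w∈ with ∈-map⁻ (λ i → a + suc i) w∈
... | i , i∈ , refl =
  subst (0 <_) (sym (+-suc a i)) z<s ,
  ≤-trans (+-monoʳ-≤ a (∈-upTo⁻ i∈)) (≤-reflexive (m+[n∸m]≡n a≤n)) ,
  m≤m+n a (suc i)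

parkSpot-spec : ∀ n k occ a v → 0 < a → a ≤ n → parkSpot n k occ a ≡ just v →
  isFree occ v ≡ true × 0 < v × v ≤ n × a ≤ v + k
parkSpot-spec n k occ a v a>0 a≤n parked with isFree occ a in free
parkSpot-spec n k occ a v a>0 a≤n refl | true = free , a>0 , a≤n , m≤m+n a k
... | false with firstFree occ (backward k a) in back
parkSpot-spec n k occ a v a>0 a≤n refl | false | just w with firstFree-spec occ (backward k a) w back
... | free′ , w∈ with backward-spec k a w w∈
... | w>0 , w≤a , a≤w+k = free′ , w>0 , ≤-trans w≤a a≤n , a≤w+k
parkSpot-spec n k occ a v a>0 a≤n parked | false | nothing with firstFree-spec occ (forward n a) v parked
... | free′ , v∈ with forward-spec n a v a≤n v∈
... | v>0 , v≤n , a≤v = free′ , v>0 , v≤n , ≤-trans a≤v (m≤m+n v k)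

-- A car preferring a spot beyond p parks beyond p ∸ k.
⟦<ᵇ⟧-parked : ∀ p k a v → a ≤ v + k → 0 < v → ⟦ p <ᵇ a ⟧ ≤ ⟦ p ∸ k <ᵇ v ⟧
⟦<ᵇ⟧-parked p k a v a≤v+k v>0 with p <? a
... | no p≮a rewrite ⟦<ᵇ⟧-no (≮⇒≥ p≮a) = z≤n
... | yes p<a with k ≤? p
...   | yes k≤p
  rewrite ⟦<ᵇ⟧-yes {p ∸ k} {v} (subst (p ∸ k <_) (m+n∸n≡m v k) (∸-monoˡ-< (<-≤-trans p<a a≤v+k) k≤p))
  = ⟦⟧≤1 _
...   | no k≰p rewrite m≤n⇒m∸n≡0 (<⇒≤ (≰⇒> k≰p)) | ⟦<ᵇ⟧-yes {0} {v} v>0 = ⟦⟧≤1 _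

runCars-invariant : ∀ n k occ as final → runCars n k occ as ≡ just final →
  Distinct occ → All (_≤ n) occ → All (InRange n) as →
  Distinct final × All (_≤ n) final × (∀ p → #> p as + #> (p ∸ k) occ ≤ #> (p ∸ k) final)
runCars-invariant n k occ [] final refl distinct occ≤ _ = distinct , occ≤ , (λ p → ≤-refl)
runCars-invariant n k occ (a ∷ as) final run distinct occ≤ ((a>0 , a≤n) ∷ as∈)
  with parkSpot n k occ a in parked
... | just v with parkSpot-spec n k occ a v a>0 a≤n parked
... | free , v>0 , v≤n , a≤v+k
  with runCars-invariant n k (v ∷ occ) as final run (free ∷ distinct) (v≤n ∷ occ≤) as∈
... | distinct′ , final≤ , grows = distinct′ , final≤ , λ p → begin
  ⟦ p <ᵇ a ⟧ + #> p as + #> (p ∸ k) occ             ≡⟨ +-assoc ⟦ p <ᵇ a ⟧ _ _ ⟩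
  ⟦ p <ᵇ a ⟧ + (#> p as + #> (p ∸ k) occ)           ≤⟨ +-monoˡ-≤ _ (⟦<ᵇ⟧-parked p k a v a≤v+k v>0) ⟩
  ⟦ p ∸ k <ᵇ v ⟧ + (#> p as + #> (p ∸ k) occ)       ≡⟨ +-left-comm ⟦ p ∸ k <ᵇ v ⟧ (#> p as) _ ⟩
  #> p as + (⟦ p ∸ k <ᵇ v ⟧ + #> (p ∸ k) occ)       ≤⟨ grows p ⟩
  #> (p ∸ k) final                                  ∎
  where
    open ≤-Reasoning

naplesPF⇒slackPF : ∀ n k t final → runCars n k [] t ≡ just final → All (InRange n) t → length t ≡ n →
  isSlackPF (k + n + 1) (k + 1) t ≡ true
naplesPF⇒slackPF n k t final run t∈ |t|≡n with runCars-invariant n k [] t final run [] [] t∈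
... | distinct , final≤n , grows = ∀<ᵇ-intro (k + n + 1) _ (λ p p<N → <ᵇ-true (slack p p<N))
  where
    above≤ : ∀ p → #> p t ≤ n ∸ (p ∸ k)
    above≤ p = ≤-trans (≤-trans (≤-reflexive (sym (+-identityʳ (#> p t)))) (grows p))
                       (#>-distinct≤ n (p ∸ k) final distinct final≤n)
    slack : ∀ p → p < k + n + 1 → p < #≤ p t + (k + 1)
    slack p p<N = subst (p <_) (regroup (#≤ p t) k)
                        (s≤s (≤-trans (m≤n+m∸n p k) (+-monoʳ-≤ k enough)))
      where
        regroup : ∀ c k → suc (k + c) ≡ c + (k + 1)
        regroup = solve-∀
        p∸k≤n : p ∸ k ≤ n
        p∸k≤n = m≤n+o⇒m∸n≤o p k (≤-pred (subst (p <_) (+-comm (k + n) 1) p<N))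
        enough : p ∸ k ≤ #≤ p t
        enough = +-cancelʳ-≤ (n ∸ (p ∸ k)) (p ∸ k) (#≤ p t) (begin
          p ∸ k + (n ∸ (p ∸ k))   ≡⟨ m+[n∸m]≡n p∸k≤n ⟩
          n                       ≡⟨ sym (trans (#≤+#>≡length p t) |t|≡n) ⟩
          #≤ p t + #> p t         ≤⟨ +-monoʳ-≤ (#≤ p t) (above≤ p) ⟩
          #≤ p t + (n ∸ (p ∸ k))  ∎)
          where open ≤-Reasoning

⟦naplesPF⟧≤⟦slackPF⟧ : ∀ n k t → All (InRange n) t → length t ≡ n →
  ⟦ isNaplesPF n k t ⟧ ≤ ⟦ isSlackPF (k + n + 1) (k + 1) t ⟧
⟦naplesPF⟧≤⟦slackPF⟧ n k t t∈ |t|≡n with runCars n k [] t in run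
... | nothing = z≤n
... | just final rewrite naplesPF⇒slackPF n k t final run t∈ |t|≡n = ≤-refl

-- The bound and its strictness

#≤-ones : ∀ m p → 1 ≤ p → #≤ p (replicate m 1) ≡ m
#≤-ones zero p 1≤p = refl
#≤-ones (suc m) p 1≤p rewrite ⟦≤ᵇ⟧-yes 1≤p = cong suc (#≤-ones m p 1≤p)

ones-inRange : ∀ N m → 1 ≤ N → All (InRange N) (replicate m 1)
ones-inRange N zero 1≤N = []
ones-inRange N (suc m) 1≤N = (z<s , 1≤N) ∷ ones-inRange N m 1≤N

slackPF-outside : ∀ k m → isSlackPF (suc k + suc m + 1) (suc k + 1) (suc (suc m) ∷ replicate m 1) ≡ true
slackPF-outside k m = ∀<ᵇ-intro N _ (λ p p<N → <ᵇ-true (slack p p<N))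
  where
    N : ℕ
    N = suc k + suc m + 1
    x : ℕ
    x = suc k + 1
    slack : ∀ p → p < N → p < #≤ p (suc (suc m) ∷ replicate m 1) + x
    slack zero _ = ≤-trans (s≤s z≤n) (m≤n+m x _)
    slack (suc p) p<N with suc (suc m) ≤? suc p
    ... | yes m+2≤p+1 rewrite ⟦≤ᵇ⟧-yes m+2≤p+1 | #≤-ones m (suc p) (s≤s z≤n) =
      subst (suc p <_) (sym (regroup k m)) p<N
      where
        regroup : ∀ k m → suc m + (suc k + 1) ≡ suc k + suc m + 1
        regroup = solve-∀
    ... | no m+2≰p+1 rewrite ⟦≤ᵇ⟧-no (≰⇒> m+2≰p+1) | #≤-ones m (suc p) (s≤s z≤n) =
      ≤-trans (≰⇒> m+2≰p+1) (subst (suc (suc m) ≤_) (sym (regroup m k)) (s≤s (s≤s (m≤m+n m k))))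
      where
        regroup : ∀ m k → m + (suc k + 1) ≡ suc (suc (m + k))
        regroup = solve-∀

n<k+n+1 : ∀ n k → n < k + n + 1
n<k+n+1 n k = subst (n <_) (sym (+-comm (k + n) 1)) (s≤s (m≤n+m n k))

numPF≤tupleSum-slackPF : ∀ n k → numPF n k ≤ tupleSum n n (⟦_⟧ ∘ isSlackPF (k + n + 1) (k + 1))
numPF≤tupleSum-slackPF n k =
  ≤-trans (≤-reflexive (length-filterᵇ-tuples n n (isNaplesPF n k)))
          (tupleSum-mono n n (⟦naplesPF⟧≤⟦slackPF⟧ n k))

numPF≤ : ∀ m k → numPF (suc m) k ≤ (k + 1) * (k + suc m + 1) ^ m
numPF≤ m k =
  ≤-trans (numPF≤tupleSum-slackPF (suc m) k)
    (≤-trans (tupleSum-mono-range (suc m) (⟦_⟧ ∘ isSlackPF (k + suc m + 1) (k + 1))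
                                  (<⇒≤ (n<k+n+1 (suc m) k)))
             (tupleSum-slackPF≤ (k + suc m + 1) (k + 1) m (regroup m k) (subst (0 <_) (+-comm 1 k) z<s)))
  where
    regroup : ∀ m k → suc m + (k + 1) ≡ k + suc m + 1
    regroup = solve-∀

numPF< : ∀ m k → numPF (suc m) (suc k) < (suc k + 1) * (suc k + suc m + 1) ^ m
numPF< m k =
  ≤-<-trans (numPF≤tupleSum-slackPF (suc m) (suc k))
    (<-≤-trans (tupleSum-<-range m w m+1<N outside)
               (tupleSum-slackPF≤ N (suc k + 1) m (regroup m k) z<s))
  where
    N : ℕ
    N = suc k + suc m + 1
    w : List ℕ → ℕ
    w = ⟦_⟧ ∘ isSlackPF N (suc k + 1)
    m+1<N : suc m < N
    m+1<N = n<k+n+1 (suc m) (suc k)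
    regroup : ∀ m k → suc m + (suc (k + 1)) ≡ suc k + suc m + 1
    regroup = solve-∀
    outside : 0 < tupleSum N m (λ t → w (suc (suc m) ∷ t))
    outside = ≤-trans (≤-reflexive (sym (cong ⟦_⟧ (slackPF-outside k m))))
                      (tupleSum-term N m (λ t → w (suc (suc m) ∷ t)) (replicate m 1)
                                     (ones-inRange N m (<-trans z<s m+1<N)) (length-replicate m))

theorem4 : (n k : ℕ) → 1 ≤ n → k ≤ n ∸ 1 →
    (numPF n k ≤ (k + 1) * (k + n + 1) ^ (n ∸ 1))
    × (numPF n k ≡ (k + 1) * (k + n + 1) ^ (n ∸ 1) → k ≡ 0)
theorem4 (suc m) zero _ _ = numPF≤ m zero , (λ _ → refl)
theorem4 (suc m) (suc k) _ _ = numPF≤ m (suc k) , (λ eq → ⊥-elim (<-irrefl eq (numPF< m k)))
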